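{- A double cycle with $n\ge 1$ vertices is $(3,1)$-colorable if and only if $n$ is even.
   Context: All graphs are finite, undirected pseudographs (multiple edges and loops allowed; a loop contributes $2$ to the degree). A double cycle on $n\ge 1$ vertices is obtained from a cycle on $n$ vertices by doubling each edge: for $n\ge3$ this is $C_n$ with every edge replaced by two parallel edges; for $n=2$ it is two vertices joined by four parallel edges; for $n=1$ it is one vertex with two loops. A $(3,1)$-coloring of a $4$-regular graph is an edge-coloring using at least two colors such that every vertex is incident to exactly $3$ edges of one color and exactly $1$ edge of a different color. -}

module Defs where

open import Data.Nat using (ℕ; zero; suc; _+_; _*_; NonZero)
open import Data.Nat.DivMod using (_mod_)
open import Data.Fin using (Fin; toℕ)
open import Data.Fin.Properties using () renaming (_≟_ to _≟ᶠ_)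
open import Data.Nat.Properties using (_≟_)
open import Data.List using (List; map; allFin)
open import Data.Nat.ListAction using (sum)
open import Data.Product using (Σ; ∃; ∃-syntax; _×_; _,_)
open import Relation.Nullary using (¬_; does)
open import Data.Bool using (if_then_else_)
open import Relation.Binary.PropositionalEquality using (_≡_)

record Pseudograph : Set where
  field
    V E : ℕ
    ends : Fin E → Fin V × Fin V

open Pseudograph public

-- number of ends of edge e at vertex x (0, 1 or 2; a loop at x gives 2)
mult : (G : Pseudograph) → Fin (E G) → Fin (V G) → ℕ
mult G e x with ends G e
... | (u , v) = (if does (u ≟ᶠ x) then 1 else 0) + (if does (v ≟ᶠ x) then 1 else 0)

degree : (G : Pseudograph) → Fin (V G) → ℕ
degree G x = sum (map (λ e → mult G e x) (allFin (E G)))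

colorDegree : (G : Pseudograph) → (Fin (E G) → ℕ) → Fin (V G) → ℕ → ℕ
colorDegree G c x a =
  sum (map (λ e → (if does (c e ≟ a) then 1 else 0) * mult G e x) (allFin (E G)))

FourRegular : Pseudograph → Set
FourRegular G = ∀ x → degree G x ≡ 4

Is31Coloring : (G : Pseudograph) → (Fin (E G) → ℕ) → Set
Is31Coloring G c =
  (∃[ e ] ∃[ e′ ] ¬ (c e ≡ c e′)) ×
  (∀ x → ∃[ a ] ∃[ b ] (¬ (a ≡ b)) × (colorDegree G c x a ≡ 3) × (colorDegree G c x b ≡ 1))

Colorable31 : Pseudograph → Set
Colorable31 G = ∃[ c ] Is31Coloring G c

-- double cycle on n ≥ 1 vertices: 2n edges, edge j joins k and k+1 (mod n)
-- where k = j mod n.  n = 2: four parallel edges; n = 1: two loops.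
doubleCycle : (n : ℕ) → .{{NonZero n}} → Pseudograph
doubleCycle n = record
  { V = n
  ; E = 2 * n
  ; ends = λ j → (toℕ j mod n , suc (toℕ j) mod n)
  }

-- Vertex x of the double cycle on N vertices meets the two parallel edges over x and the two
-- over its cyclic predecessor.  If one colour has degree 3 at x, one of these two pairs is
-- monochromatic and the other is not, so monochromatic and bichromatic pairs alternate around
-- the cycle, which forces N to be even.  Conversely, for even N, colour both edges of each odd
-- pair with 0 and the two edges of each even pair with 0 and 1.
module Submission where

open import Defs
open import Data.Bool using (Bool; true; false; not; _xor_; if_then_else_)
open import Data.Bool.Properties using (not-involutive; not-distribˡ-xor)
open import Data.Fin using (Fin; zero; suc; toℕ; fromℕ; fromℕ<; inject₁; punchIn; combine; remQuot)
open import Data.Fin.Properties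
  using ( toℕ-injective; toℕ-fromℕ; toℕ-fromℕ<; toℕ-inject₁; toℕ<n; punchInᵢ≢i; toℕ-combine
        ; combine-injectiveˡ; combine-injectiveʳ; combine-surjective; remQuot-combine)
  renaming (_≟_ to _≟ᶠ_)
open import Data.List using (map; allFin; tabulate)
open import Data.List.Properties using (map-tabulate)
open import Data.Nat using (ℕ; zero; suc; _+_; _*_; _≤_; s≤s; z≤n; _≟_)
open import Data.Nat.DivMod using (_mod_; _%_; [m+kn]%n≡m%n; m<n⇒m%n≡m; n%n≡0)
open import Data.Nat.Divisibility using (_∣_; ∣-refl; ∣m∣n⇒∣m+n; ∣m+n∣m⇒∣n; ∣⇒≤)
open import Data.Nat.ListAction using (sum)
open import Data.Nat.Properties
  using (+-*-semiring; +-identityʳ; *-identityʳ; *-zeroʳ; *-distribˡ-+; +-mono-≤; 0≢1+n; m<1+n⇒m<n∨m≡n)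
open import Data.Nat.Tactic.RingSolver using (solve-∀)
open import Data.Product using (_×_; _,_; uncurry)
open import Data.Sum using (_⊎_; inj₁; inj₂; [_,_])
open import Function using (_∘_)
open import Relation.Nullary using (Dec; does; yes; no; ¬_)
open import Relation.Nullary.Decidable using (dec-true; dec-false)
open import Relation.Binary.PropositionalEquality
  using (_≡_; _≢_; refl; sym; trans; cong; cong₂; module ≡-Reasoning)
open import Algebra.Properties.Semiring.Sum +-*-semiring
  using (sum-remove; sum-cong-≗; sum-replicate-zero; ∑-distrib-+) renaming (sum to ∑)

𝟙 : {P : Set} → Dec P → ℕ
𝟙 d = if does d then 1 else 0

𝟙-yes : {P : Set} (p? : Dec P) → P → 𝟙 p? ≡ 1
𝟙-yes p? p = cong (if_then 1 else 0) (dec-true p? p)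

𝟙-no : {P : Set} (p? : Dec P) → ¬ P → 𝟙 p? ≡ 0
𝟙-no p? ¬p = cong (if_then 1 else 0) (dec-false p? ¬p)

𝟙≤1 : {P : Set} (p? : Dec P) → 𝟙 p? ≤ 1
𝟙≤1 (yes _) = s≤s z≤n
𝟙≤1 (no _)  = z≤n

𝟙-⇔ : {P Q : Set} (p? : Dec P) (q? : Dec Q) → (P → Q) → (Q → P) → 𝟙 p? ≡ 𝟙 q?
𝟙-⇔ p? (yes q) to from = 𝟙-yes p? (from q)
𝟙-⇔ p? (no ¬q) to from = 𝟙-no p? (¬q ∘ to)

𝟙-⊎ : {P Q R : Set} (p? : Dec P) (q? : Dec Q) (r? : Dec R) →
      (P → Q ⊎ R) → (Q ⊎ R → P) → (Q → ¬ R) → 𝟙 p? ≡ 𝟙 q? + 𝟙 r?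
𝟙-⊎ p? (yes q) r?      to from disjoint =
  trans (𝟙-yes p? (from (inj₁ q))) (cong (1 +_) (sym (𝟙-no r? (disjoint q))))
𝟙-⊎ p? (no ¬q) (yes r) to from disjoint = 𝟙-yes p? (from (inj₂ r))
𝟙-⊎ p? (no ¬q) (no ¬r) to from disjoint = 𝟙-no p? ([ ¬q , ¬r ] ∘ to)

𝟙+𝟙≡2⇒≡ : {A : Set} {u v a : A} (u? : Dec (u ≡ a)) (v? : Dec (v ≡ a)) → 𝟙 u? + 𝟙 v? ≡ 2 → u ≡ v
𝟙+𝟙≡2⇒≡ (yes u≡a) (yes v≡a) _ = trans u≡a (sym v≡a)
𝟙+𝟙≡2⇒≡ (yes _)   (no _)    ()
𝟙+𝟙≡2⇒≡ (no _)    (yes _)   ()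
𝟙+𝟙≡2⇒≡ (no _)    (no _)    ()

𝟙+𝟙≡1⇒≢ : {A : Set} {u v a : A} (u? : Dec (u ≡ a)) (v? : Dec (v ≡ a)) → 𝟙 u? + 𝟙 v? ≡ 1 → u ≢ v
𝟙+𝟙≡1⇒≢ (yes u≡a) (no v≢a)  _ u≡v = v≢a (trans (sym u≡v) u≡a)
𝟙+𝟙≡1⇒≢ (no u≢a)  (yes v≡a) _ u≡v = u≢a (trans u≡v v≡a)
𝟙+𝟙≡1⇒≢ (yes _)   (yes _)   ()
𝟙+𝟙≡1⇒≢ (no _)    (no _)    ()

m+n≡3⇒2+1⊎1+2 : ∀ {m n} → m ≤ 2 → n ≤ 2 → m + n ≡ 3 → (m ≡ 2 × n ≡ 1) ⊎ (m ≡ 1 × n ≡ 2)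
m+n≡3⇒2+1⊎1+2 {0}                 _              (s≤s (s≤s ())) refl
m+n≡3⇒2+1⊎1+2 {1}                 _              _              refl = inj₂ (refl , refl)
m+n≡3⇒2+1⊎1+2 {2}                 _              _              refl = inj₁ (refl , refl)
m+n≡3⇒2+1⊎1+2 {suc (suc (suc _))} (s≤s (s≤s ())) _              _

sum-allFin : ∀ {M} (f : Fin M → ℕ) → sum (map f (allFin M)) ≡ ∑ f
sum-allFin f = trans (cong sum (map-tabulate (λ e → e) f)) (sum-tabulate f)
  where
  sum-tabulate : ∀ {M} (f : Fin M → ℕ) → sum (tabulate f) ≡ ∑ f
  sum-tabulate {zero}  f = refl
  sum-tabulate {suc M} f = cong (f zero +_) (sum-tabulate (f ∘ suc))

∑-δ : ∀ {M} (f : Fin M → ℕ) (p : Fin M) → ∑ (λ e → f e * 𝟙 (e ≟ᶠ p)) ≡ f p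
∑-δ {suc M} f p = begin
  ∑ g                             ≡⟨ sum-remove {i = p} g ⟩
  g p + ∑ (λ j → g (punchIn p j)) ≡⟨ cong₂ _+_ (cong (f p *_) (𝟙-yes (p ≟ᶠ p) refl)) rest≡0 ⟩
  f p * 1 + 0                     ≡⟨ trans (+-identityʳ (f p * 1)) (*-identityʳ (f p)) ⟩
  f p                             ∎
  where
  open ≡-Reasoning
  g : Fin (suc M) → ℕ
  g e = f e * 𝟙 (e ≟ᶠ p)
  off-p : ∀ j → g (punchIn p j) ≡ 0
  off-p j = trans (cong (f (punchIn p j) *_) (𝟙-no (punchIn p j ≟ᶠ p) (punchInᵢ≢i p j)))
                  (*-zeroʳ (f (punchIn p j)))
  rest≡0 : ∑ (λ j → g (punchIn p j)) ≡ 0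
  rest≡0 = trans (sum-cong-≗ off-p) (sum-replicate-zero M)

∑-δ₂ : ∀ {M} (f : Fin M → ℕ) (p q : Fin M) →
       ∑ (λ e → f e * (𝟙 (e ≟ᶠ p) + 𝟙 (e ≟ᶠ q))) ≡ f p + f q
∑-δ₂ f p q = begin
  ∑ (λ e → f e * (𝟙 (e ≟ᶠ p) + 𝟙 (e ≟ᶠ q)))
    ≡⟨ sum-cong-≗ (λ e → *-distribˡ-+ (f e) (𝟙 (e ≟ᶠ p)) (𝟙 (e ≟ᶠ q))) ⟩
  ∑ (λ e → f e * 𝟙 (e ≟ᶠ p) + f e * 𝟙 (e ≟ᶠ q))
    ≡⟨ ∑-distrib-+ (λ e → f e * 𝟙 (e ≟ᶠ p)) (λ e → f e * 𝟙 (e ≟ᶠ q)) ⟩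
  ∑ (λ e → f e * 𝟙 (e ≟ᶠ p)) + ∑ (λ e → f e * 𝟙 (e ≟ᶠ q))
    ≡⟨ cong₂ _+_ (∑-δ f p) (∑-δ f q) ⟩
  f p + f q ∎
  where open ≡-Reasoning

colorDegree-∑ : (G : Pseudograph) (c : Fin (E G) → ℕ) (x : Fin (V G)) (a : ℕ) →
                colorDegree G c x a ≡ ∑ (λ e → 𝟙 (c e ≟ a) * mult G e x)
colorDegree-∑ G c x a = sum-allFin (λ e → 𝟙 (c e ≟ a) * mult G e x)

odd : ℕ → Bool
odd zero    = false
odd (suc n) = not (odd n)

odd⇒2∣suc : ∀ n → odd n ≡ true → 2 ∣ suc n
odd⇒2∣suc zero          ()
odd⇒2∣suc (suc zero)    _   = ∣-refl
odd⇒2∣suc (suc (suc n)) odd-n+2 =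
  ∣m∣n⇒∣m+n (∣-refl {2}) (odd⇒2∣suc n (trans (sym (not-involutive (odd n))) odd-n+2))

2∣suc⇒odd : ∀ n → 2 ∣ suc n → odd n ≡ true
2∣suc⇒odd zero          2∣1 with s≤s () ← ∣⇒≤ 2∣1
2∣suc⇒odd (suc zero)    _   = refl
2∣suc⇒odd (suc (suc n)) 2∣  =
  trans (not-involutive (odd n)) (2∣suc⇒odd n (∣m+n∣m⇒∣n 2∣ (∣-refl {2})))

prev : ∀ {n} → Fin (suc n) → Fin (suc n)
prev {n} zero = fromℕ n
prev (suc i)  = inject₁ i

Alternating : ∀ {n} → (Fin (suc n) → Bool) → Set
Alternating f = ∀ x → f x ≡ not (f (prev x))

flipping⇒odd-xor : ∀ {n} (f : Fin (suc n) → Bool) → (∀ i → f (suc i) ≡ not (f (inject₁ i))) →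
                   ∀ i → f i ≡ odd (toℕ i) xor f zero
flipping⇒odd-xor f flips zero = refl
flipping⇒odd-xor {suc n} f flips (suc i) = begin
  f (suc i)                    ≡⟨ flips i ⟩
  not (f (inject₁ i))          ≡⟨ cong not (flipping⇒odd-xor (f ∘ inject₁) (flips ∘ inject₁) i) ⟩
  not (odd (toℕ i) xor f zero) ≡⟨ not-distribˡ-xor (odd (toℕ i)) (f zero) ⟩
  odd (toℕ (suc i)) xor f zero ∎
  where open ≡-Reasoning

alternating⇒2∣ : ∀ {n} (f : Fin (suc n) → Bool) → Alternating f → 2 ∣ suc n
alternating⇒2∣ {n} f alt = odd⇒2∣suc n (closes (odd n) (f zero) (begin
  f zero                               ≡⟨ alt zero ⟩
  not (f (fromℕ n))                    ≡⟨ cong not (flipping⇒odd-xor f (alt ∘ suc) (fromℕ n)) ⟩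
  not (odd (toℕ (fromℕ n)) xor f zero) ≡⟨ cong (λ m → not (odd m xor f zero)) (toℕ-fromℕ n) ⟩
  not (odd n xor f zero)               ∎))
  where
  open ≡-Reasoning
  closes : ∀ o b → b ≡ not (o xor b) → o ≡ true
  closes true  _     _  = refl
  closes false false ()
  closes false true  ()

2∣⇒alternating-odd : ∀ {n} → 2 ∣ suc n → Alternating (λ (x : Fin (suc n)) → odd (toℕ x))
2∣⇒alternating-odd {n} 2∣ zero = begin
  not true                  ≡⟨ cong not (sym (2∣suc⇒odd n 2∣)) ⟩
  not (odd n)               ≡⟨ cong (not ∘ odd) (sym (toℕ-fromℕ n)) ⟩
  not (odd (toℕ (fromℕ n))) ∎
  where open ≡-Reasoning
2∣⇒alternating-odd 2∣ (suc i) = cong (not ∘ odd) (sym (toℕ-inject₁ i))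

toℕ-mod : ∀ {n} (r : Fin (suc n)) → toℕ r mod suc n ≡ r
toℕ-mod r = toℕ-injective (trans (toℕ-fromℕ< _) (m<n⇒m%n≡m (toℕ<n r)))

+combine-mod : ∀ {k n} (m : ℕ) (q : Fin k) (r : Fin (suc n)) →
               (m + toℕ (combine q r)) mod suc n ≡ (m + toℕ r) mod suc n
+combine-mod {n = n} m q r = toℕ-injective (begin
  toℕ ((m + toℕ (combine q r)) mod suc n) ≡⟨ toℕ-fromℕ< _ ⟩
  (m + toℕ (combine q r)) % suc n         ≡⟨ cong (λ t → (m + t) % suc n) (toℕ-combine q r) ⟩
  (m + (suc n * toℕ q + toℕ r)) % suc n   ≡⟨ cong (_% suc n) (regroup m (suc n) (toℕ q) (toℕ r)) ⟩
  (m + toℕ r + toℕ q * suc n) % suc n     ≡⟨ [m+kn]%n≡m%n (m + toℕ r) (toℕ q) (suc n) ⟩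
  (m + toℕ r) % suc n                     ≡⟨ toℕ-fromℕ< _ ⟨
  toℕ ((m + toℕ r) mod suc n)             ∎)
  where
  open ≡-Reasoning
  regroup : ∀ m n k r → m + (n * k + r) ≡ m + r + k * n
  regroup = solve-∀

suc-mod-prev : ∀ {n} (x : Fin (suc n)) → suc (toℕ (prev x)) mod suc n ≡ x
suc-mod-prev {n} zero = toℕ-injective (begin
  toℕ (suc (toℕ (fromℕ n)) mod suc n) ≡⟨ toℕ-fromℕ< _ ⟩
  suc (toℕ (fromℕ n)) % suc n         ≡⟨ cong (λ t → suc t % suc n) (toℕ-fromℕ n) ⟩
  suc n % suc n                       ≡⟨ n%n≡0 (suc n) ⟩
  0                                   ∎)
  where open ≡-Reasoning
suc-mod-prev {n} (suc i) = toℕ-injective (begin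
  toℕ (suc (toℕ (inject₁ i)) mod suc n) ≡⟨ toℕ-fromℕ< _ ⟩
  suc (toℕ (inject₁ i)) % suc n         ≡⟨ cong (λ t → suc t % suc n) (toℕ-inject₁ i) ⟩
  suc (toℕ i) % suc n                   ≡⟨ m<n⇒m%n≡m (s≤s (toℕ<n i)) ⟩
  suc (toℕ i)                           ∎)
  where open ≡-Reasoning

prev-suc-mod : ∀ {n} (r : Fin (suc n)) → prev (suc (toℕ r) mod suc n) ≡ r
prev-suc-mod {n} r with m<1+n⇒m<n∨m≡n (toℕ<n r)
... | inj₂ r≡n = toℕ-injective (begin
  toℕ (prev (suc (toℕ r) mod suc n)) ≡⟨ cong (toℕ ∘ prev) wraps ⟩
  toℕ (fromℕ n)                      ≡⟨ toℕ-fromℕ n ⟩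
  n                                  ≡⟨ r≡n ⟨
  toℕ r                              ∎)
  where
  open ≡-Reasoning
  wraps : suc (toℕ r) mod suc n ≡ zero
  wraps = toℕ-injective (trans (toℕ-fromℕ< _) (trans (cong (λ t → suc t % suc n) r≡n) (n%n≡0 (suc n))))
... | inj₁ r<n = toℕ-injective (begin
  toℕ (prev (suc (toℕ r) mod suc n)) ≡⟨ cong (toℕ ∘ prev) steps ⟩
  toℕ (inject₁ (fromℕ< r<n))         ≡⟨ toℕ-inject₁ (fromℕ< r<n) ⟩
  toℕ (fromℕ< r<n)                   ≡⟨ toℕ-fromℕ< r<n ⟩
  toℕ r                              ∎)
  where
  open ≡-Reasoning
  steps : suc (toℕ r) mod suc n ≡ suc (fromℕ< r<n)
  steps = toℕ-injective (trans (toℕ-fromℕ< _) (trans (m<n⇒m%n≡m (s≤s r<n)) (cong suc (sym (toℕ-fromℕ< r<n)))))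

-- Edge number k * q + r of doubleCycle k: the q-th of the two parallel edges joining r to its
-- cyclic successor.
copy : ∀ {k} → Fin 2 → Fin k → Fin (2 * k)
copy = combine

𝟙-copy : ∀ {k} (q : Fin 2) (r x : Fin k) →
         𝟙 (r ≟ᶠ x) ≡ 𝟙 (copy q r ≟ᶠ copy zero x) + 𝟙 (copy q r ≟ᶠ copy (suc zero) x)
𝟙-copy q r x = 𝟙-⊎ (r ≟ᶠ x) (copy q r ≟ᶠ _) (copy q r ≟ᶠ _) to from disjoint
  where
  either-copy : ∀ q → copy q r ≡ copy zero r ⊎ copy q r ≡ copy (suc zero) r
  either-copy zero       = inj₁ refl
  either-copy (suc zero) = inj₂ refl
  to : r ≡ x → copy q r ≡ copy zero x ⊎ copy q r ≡ copy (suc zero) x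
  to refl = either-copy q
  from : copy q r ≡ copy zero x ⊎ copy q r ≡ copy (suc zero) x → r ≡ x
  from = [ combine-injectiveʳ q r zero x , combine-injectiveʳ q r (suc zero) x ]
  disjoint : copy q r ≡ copy zero x → copy q r ≢ copy (suc zero) x
  disjoint e₀ e₁ with () ← combine-injectiveˡ {2} zero x (suc zero) x (trans (sym e₀) e₁)

mult-doubleCycle : ∀ {n} (e : Fin (2 * suc n)) (x : Fin (suc n)) →
  mult (doubleCycle (suc n)) e x ≡
    (𝟙 (e ≟ᶠ copy zero x) + 𝟙 (e ≟ᶠ copy (suc zero) x)) +
    (𝟙 (e ≟ᶠ copy zero (prev x)) + 𝟙 (e ≟ᶠ copy (suc zero) (prev x)))
mult-doubleCycle {n} e x with q , r , refl ← combine-surjective {2} {suc n} e = cong₂ _+_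
  (begin
    𝟙 (toℕ (copy q r) mod suc n ≟ᶠ x) ≡⟨ cong (λ t → 𝟙 (t ≟ᶠ x)) (trans (+combine-mod 0 q r) (toℕ-mod r)) ⟩
    𝟙 (r ≟ᶠ x)                        ≡⟨ 𝟙-copy q r x ⟩
    _                                 ∎)
  (begin
    𝟙 (suc (toℕ (copy q r)) mod suc n ≟ᶠ x) ≡⟨ cong (λ t → 𝟙 (t ≟ᶠ x)) (+combine-mod 1 q r) ⟩
    𝟙 (suc (toℕ r) mod suc n ≟ᶠ x)          ≡⟨ 𝟙-⇔ (suc (toℕ r) mod suc n ≟ᶠ x) (r ≟ᶠ prev x) to from ⟩
    𝟙 (r ≟ᶠ prev x)                         ≡⟨ 𝟙-copy q r (prev x) ⟩
    _                                       ∎)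
  where
  open ≡-Reasoning
  to : suc (toℕ r) mod suc n ≡ x → r ≡ prev x
  to eq = trans (sym (prev-suc-mod r)) (cong prev eq)
  from : r ≡ prev x → suc (toℕ r) mod suc n ≡ x
  from refl = suc-mod-prev x

pairColorCount : ∀ {k} → (Fin (2 * k) → ℕ) → ℕ → Fin k → ℕ
pairColorCount c a r = 𝟙 (c (copy zero r) ≟ a) + 𝟙 (c (copy (suc zero) r) ≟ a)

pairColorCount≤2 : ∀ {k} (c : Fin (2 * k) → ℕ) (a : ℕ) (r : Fin k) → pairColorCount c a r ≤ 2
pairColorCount≤2 {k} c a r =
  +-mono-≤ (𝟙≤1 (c (copy {k} zero r) ≟ a)) (𝟙≤1 (c (copy {k} (suc zero) r) ≟ a))

colorDegree-doubleCycle : ∀ {n} (c : Fin (2 * suc n) → ℕ) (x : Fin (suc n)) (a : ℕ) →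
  colorDegree (doubleCycle (suc n)) c x a ≡ pairColorCount c a x + pairColorCount c a (prev x)
colorDegree-doubleCycle {n} c x a = begin
  colorDegree G c x a                          ≡⟨ colorDegree-∑ G c x a ⟩
  ∑ (λ e → w e * mult G e x)                   ≡⟨ sum-cong-≗ (λ e → cong (w e *_) (mult-doubleCycle e x)) ⟩
  ∑ (λ e → w e * (δ x e + δ (prev x) e))       ≡⟨ sum-cong-≗ (λ e → *-distribˡ-+ (w e) (δ x e) (δ (prev x) e)) ⟩
  ∑ (λ e → w e * δ x e + w e * δ (prev x) e)   ≡⟨ ∑-distrib-+ (λ e → w e * δ x e) (λ e → w e * δ (prev x) e) ⟩
  ∑ (λ e → w e * δ x e) + ∑ (λ e → w e * δ (prev x) e)
    ≡⟨ cong₂ _+_ (∑-δ₂ w (copy zero x) _) (∑-δ₂ w (copy zero (prev x)) _) ⟩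
  pairColorCount c a x + pairColorCount c a (prev x) ∎
  where
  open ≡-Reasoning
  G = doubleCycle (suc n)
  w : Fin (2 * suc n) → ℕ
  w e = 𝟙 (c e ≟ a)
  δ : Fin (suc n) → Fin (2 * suc n) → ℕ
  δ r e = 𝟙 (e ≟ᶠ copy zero r) + 𝟙 (e ≟ᶠ copy (suc zero) r)

isMonochromatic : ∀ {k} → (Fin (2 * k) → ℕ) → Fin k → Bool
isMonochromatic c r = does (c (copy zero r) ≟ c (copy (suc zero) r))

pairColorCount≡2⇒monochromatic : ∀ {k} (c : Fin (2 * k) → ℕ) (a : ℕ) (r : Fin k) →
                                 pairColorCount c a r ≡ 2 → isMonochromatic c r ≡ true
pairColorCount≡2⇒monochromatic {k} c a r two =
  dec-true (c (copy {k} zero r) ≟ _) (𝟙+𝟙≡2⇒≡ (c (copy {k} zero r) ≟ a) (c (copy {k} (suc zero) r) ≟ a) two)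

pairColorCount≡1⇒bichromatic : ∀ {k} (c : Fin (2 * k) → ℕ) (a : ℕ) (r : Fin k) →
                               pairColorCount c a r ≡ 1 → isMonochromatic c r ≡ false
pairColorCount≡1⇒bichromatic {k} c a r one =
  dec-false (c (copy {k} zero r) ≟ _) (𝟙+𝟙≡1⇒≢ (c (copy {k} zero r) ≟ a) (c (copy {k} (suc zero) r) ≟ a) one)

colorDegree≡3⇒isMonochromatic-flips :
  ∀ {n} (c : Fin (2 * suc n) → ℕ) (x : Fin (suc n)) (a : ℕ) →
  colorDegree (doubleCycle (suc n)) c x a ≡ 3 → isMonochromatic c x ≡ not (isMonochromatic c (prev x))
colorDegree≡3⇒isMonochromatic-flips c x a deg≡3
  with m+n≡3⇒2+1⊎1+2 (pairColorCount≤2 c a x) (pairColorCount≤2 c a (prev x))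
                     (trans (sym (colorDegree-doubleCycle c x a)) deg≡3)
... | inj₁ (two , one) = trans (pairColorCount≡2⇒monochromatic c a x two)
                               (cong not (sym (pairColorCount≡1⇒bichromatic c a (prev x) one)))
... | inj₂ (one , two) = trans (pairColorCount≡1⇒bichromatic c a x one)
                               (cong not (sym (pairColorCount≡2⇒monochromatic c a (prev x) two)))

colorable⇒2∣ : ∀ n → Colorable31 (doubleCycle (suc n)) → 2 ∣ suc n
colorable⇒2∣ n (c , _ , local) = alternating⇒2∣ (isMonochromatic c) flips
  where
  flips : Alternating (isMonochromatic c)
  flips x with a , _ , _ , deg≡3 , _ ← local x = colorDegree≡3⇒isMonochromatic-flips c x a deg≡3

paint : Bool → Fin 2 → ℕ
paint b q = if b then 0 else toℕ q

alternatingColoring : ∀ {k} → Fin (2 * k) → ℕ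
alternatingColoring {k} e = uncurry (λ q r → paint (odd (toℕ r)) q) (remQuot {2} k e)

alternatingColoring-copy : ∀ {k} (q : Fin 2) (r : Fin k) →
                           alternatingColoring {k} (copy q r) ≡ paint (odd (toℕ r)) q
alternatingColoring-copy q r = cong (uncurry (λ q r → paint (odd (toℕ r)) q)) (remQuot-combine q r)

tally : Bool → ℕ → ℕ
tally b a = 𝟙 (paint b zero ≟ a) + 𝟙 (paint b (suc zero) ≟ a)

pairColorCount-alternatingColoring : ∀ {k} (a : ℕ) (r : Fin k) →
  pairColorCount (alternatingColoring {k}) a r ≡ tally (odd (toℕ r)) a
pairColorCount-alternatingColoring {k} a r = cong₂ _+_ (colour zero) (colour (suc zero))
  where
  colour : ∀ q → 𝟙 (alternatingColoring {k} (copy q r) ≟ a) ≡ 𝟙 (paint (odd (toℕ r)) q ≟ a)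
  colour q = cong (λ m → 𝟙 (m ≟ a)) (alternatingColoring-copy q r)

colorDegree-alternatingColoring : ∀ {n} → 2 ∣ suc n → (x : Fin (suc n)) (a : ℕ) →
  colorDegree (doubleCycle (suc n)) (alternatingColoring {suc n}) x a ≡
    tally (not (odd (toℕ (prev x)))) a + tally (odd (toℕ (prev x))) a
colorDegree-alternatingColoring {n} 2∣ x a = begin
  colorDegree (doubleCycle (suc n)) c x a
    ≡⟨ colorDegree-doubleCycle c x a ⟩
  pairColorCount c a x + pairColorCount c a (prev x)
    ≡⟨ cong₂ _+_ (pairColorCount-alternatingColoring a x) (pairColorCount-alternatingColoring a (prev x)) ⟩
  tally (odd (toℕ x)) a + tally (odd (toℕ (prev x))) a
    ≡⟨ cong (λ b → tally b a + tally (odd (toℕ (prev x))) a) (2∣⇒alternating-odd 2∣ x) ⟩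
  tally (not (odd (toℕ (prev x)))) a + tally (odd (toℕ (prev x))) a ∎
  where
  open ≡-Reasoning
  c = alternatingColoring {suc n}

2∣⇒colorable : ∀ n → 2 ∣ suc n → Colorable31 (doubleCycle (suc n))
2∣⇒colorable n 2∣ =
  alternatingColoring {suc n} , (copy zero zero , copy (suc zero) zero , differ) ,
  λ x → 0 , 1 , (λ ()) , trans (colorDegree-alternatingColoring 2∣ x 0) (three (odd (toℕ (prev x))))
                       , trans (colorDegree-alternatingColoring 2∣ x 1) (one (odd (toℕ (prev x))))
  where
  differ : alternatingColoring {suc n} (copy zero zero) ≢ alternatingColoring {suc n} (copy (suc zero) zero)
  differ eq = 0≢1+n (trans (sym (alternatingColoring-copy {suc n} zero zero))
                           (trans eq (alternatingColoring-copy {suc n} (suc zero) zero)))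
  three : ∀ b → tally (not b) 0 + tally b 0 ≡ 3
  three true  = refl
  three false = refl
  one : ∀ b → tally (not b) 1 + tally b 1 ≡ 1
  one true  = refl
  one false = refl

lemma1 : (n : ℕ) → (Colorable31 (doubleCycle (suc n)) → 2 ∣ suc n) × (2 ∣ suc n → Colorable31 (doubleCycle (suc n)))
lemma1 n = colorable⇒2∣ n , 2∣⇒colorable n
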